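{- Every consistent theory of $L([1],[\omega],\mathtt u,\mathtt U)$ can be extended to a complete theory.
   Context: Let $Var=\{p_n : n\in\omega\}$. Formulas are built from $Var$ using unary $\lnot$, $[1]$, $[\omega]$ and binary $\land$, $\mathtt u$, $\mathtt U$; $\lor,\to,\leftrightarrow$ are defined as usual; $\mathtt f\phi:=(\phi\to\phi)\,\mathtt u\,\phi$, $\mathtt g\phi:=\lnot\mathtt f\lnot\phi$; $[a]^0\phi=\phi$, $[a]^{n+1}\phi=[a][a]^n\phi$ for $a\in\{1,\omega\}$. A theory is a nonempty set of formulas. Axioms are all instances of: A1 tautology instances; A2 $[1][\omega]\phi\leftrightarrow[\omega]\phi$; A3 $\lnot[a]\phi\leftrightarrow[a]\lnot\phi$, $a\in\{1,\omega\}$; A4 $[a](\phi*\psi)\leftrightarrow([a]\phi*[a]\psi)$ for $a\in\{1,\omega\}$, $*\in\{\land,\lor,\to,\leftrightarrow\}$; A5 $\psi\to(\phi\,\mathtt u\,\psi)$; A6 $\phi\,\mathtt u\,\psi\to\phi\,\mathtt U\,\psi$; A7 $\left(\bigwedge_{k=0}^n[1]^k(\phi\land\lnot\psi)\land[1]^{n+1}\psi\right)\to\phi\,\mathtt u\,\psi$; A8 $\left(\bigwedge_{k=0}^n[\omega]^k\mathtt g(\phi\land\lnot\psi)\land[\omega]^{n+1}(\phi\,\mathtt u\,\psi)\right)\to\phi\,\mathtt U\,\psi$ (for all $n\in\omega$). Rules: R1 modus ponens; R2 necessitation: from $\phi$ infer $[a]\phi$, $a\in\{1,\omega\}$; R3: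 from $\theta\to\lnot\psi$ and all $\theta\to\bigvee_{k=0}^n[1]^k(\lnot\phi\lor\psi)\lor[1]^{n+1}\lnot\psi$ ($n\in\omega$) infer $\theta\to\lnot(\phi\,\mathtt u\,\psi)$; R4: from $\theta\to\lnot(\phi\,\mathtt u\,\psi)$ and all $\theta\to\bigvee_{k=0}^n[\omega]^k\lnot\mathtt g(\phi\land\lnot\psi)\lor[\omega]^{n+1}\lnot(\phi\,\mathtt u\,\psi)$ ($n\in\omega$) infer $\theta\to\lnot(\phi\,\mathtt U\,\psi)$. $T\vdash\phi$ iff there is a sequence of formulas of order type $\alpha+1$ for some countable ordinal $\alpha$ ending in $\phi$, each member being an axiom, an element of $T$, or obtained from earlier members by a rule, with necessitation applied only to theorems (formulas derivable in this way from the empty set). $T$ is consistent iff there is no formula $\chi$ with both $T\vdash\chi$ and $T\vdash\lnot\chi$. A theory $T$ is complete iff it is consistent and for every formula $\phi$, $T\vdash\phi$ or $T\vdash\lnot\phi$. -}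

module Defs where

open import Data.Nat using (ℕ; zero; suc)
open import Data.Bool using (Bool; true; false; not; _∧_)
open import Data.Empty using (⊥)
open import Data.Product using (Σ; _×_)
open import Data.Sum using (_⊎_)
open import Relation.Nullary using (¬_)
open import Relation.Binary.PropositionalEquality using (_≡_)

data Formula : Set where
  var   : ℕ → Formula
  ~_    : Formula → Formula
  [1]_  : Formula → Formula
  [ω]_  : Formula → Formula
  _∧'_  : Formula → Formula → Formula
  _u_   : Formula → Formula → Formula
  _U_   : Formula → Formula → Formula

infixr 30 ~_ [1]_ [ω]_
infixr 20 _∧'_ _∨'_
infixr 10 _⇒_ _⇔_
infixr 30 [_]_ [_]^_$_
infix 5 _⊢_

_∨'_ : Formula → Formula → Formula
φ ∨' ψ = ~ (~ φ ∧' ~ ψ)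

_⇒_ : Formula → Formula → Formula
φ ⇒ ψ = ~ φ ∨' ψ

_⇔_ : Formula → Formula → Formula
φ ⇔ ψ = (φ ⇒ ψ) ∧' (ψ ⇒ φ)

f : Formula → Formula
f φ = (φ ⇒ φ) u φ

g : Formula → Formula
g φ = ~ f (~ φ)

data Op : Set where
  one omega : Op

[_]_ : Op → Formula → Formula
[ one ] φ = [1] φ
[ omega ] φ = [ω] φ

[_]^_$_ : Op → ℕ → Formula → Formula
[ a ]^ zero $ φ = φ
[ a ]^ suc n $ φ = [ a ] ([ a ]^ n $ φ)

data BinC : Set where
  cand cor cimp ciff : BinC

bin : BinC → Formula → Formula → Formula
bin cand = _∧'_
bin cor  = _∨'_
bin cimp = _⇒_
bin ciff = _⇔_

bigAnd : (ℕ → Formula) → ℕ → Formula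
bigAnd h zero = h zero
bigAnd h (suc n) = bigAnd h n ∧' h (suc n)

bigOr : (ℕ → Formula) → ℕ → Formula
bigOr h zero = h zero
bigOr h (suc n) = bigOr h n ∨' h (suc n)

-- Tautology instances: the propositional skeleton (subformulas not of the
-- form ¬/∧ treated as atoms) is true under every Boolean valuation.
evalP : (Formula → Bool) → Formula → Bool
evalP v (~ φ) = not (evalP v φ)
evalP v (φ ∧' ψ) = evalP v φ ∧ evalP v ψ
evalP v φ = v φ

TautInstance : Formula → Set
TautInstance φ = (v : Formula → Bool) → evalP v φ ≡ true

data Axiom : Formula → Set where
  A1 : ∀ {φ} → TautInstance φ → Axiom φ
  A2 : ∀ φ → Axiom ([1] [ω] φ ⇔ [ω] φ)
  A3 : ∀ a φ → Axiom (~ ([ a ] φ) ⇔ [ a ] (~ φ))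
  A4 : ∀ a c φ ψ → Axiom ([ a ] (bin c φ ψ) ⇔ bin c ([ a ] φ) ([ a ] ψ))
  A5 : ∀ φ ψ → Axiom (ψ ⇒ (φ u ψ))
  A6 : ∀ φ ψ → Axiom ((φ u ψ) ⇒ (φ U ψ))
  A7 : ∀ φ ψ n → Axiom ((bigAnd (λ k → [ one ]^ k $ (φ ∧' ~ ψ)) n
                           ∧' [ one ]^ suc n $ ψ) ⇒ (φ u ψ))
  A8 : ∀ φ ψ n → Axiom ((bigAnd (λ k → [ omega ]^ k $ g (φ ∧' ~ ψ)) n
                           ∧' [ omega ]^ suc n $ (φ u ψ)) ⇒ (φ U ψ))

-- Theories are sets of formulas (nonemptiness is imposed separately)
Theory : Set₁
Theory = Formula → Set

∅ : Theory
∅ _ = ⊥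

NonEmpty : Theory → Set
NonEmpty T = Σ Formula T

_⊆_ : Theory → Theory → Set
T ⊆ T' = ∀ φ → T φ → T' φ

-- Infinitary derivability, as the inductive closure (well-founded proof
-- trees with countably branching rules R3, R4). Necessitation only applies
-- to theorems, i.e. formulas derivable from the empty set.
data _⊢_ : Theory → Formula → Set₁ where
  ax  : ∀ {T φ} → Axiom φ → T ⊢ φ
  hyp : ∀ {T φ} → T φ → T ⊢ φ
  R1  : ∀ {T φ ψ} → T ⊢ φ → T ⊢ (φ ⇒ ψ) → T ⊢ ψ
  R2  : ∀ {T φ} a → ∅ ⊢ φ → T ⊢ [ a ] φ
  R3  : ∀ {T θ φ ψ}
        → T ⊢ (θ ⇒ ~ ψ)
        → (∀ n → T ⊢ (θ ⇒ (bigOr (λ k → [ one ]^ k $ (~ φ ∨' ψ)) n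
                              ∨' [ one ]^ suc n $ (~ ψ))))
        → T ⊢ (θ ⇒ ~ (φ u ψ))
  R4  : ∀ {T θ φ ψ}
        → T ⊢ (θ ⇒ ~ (φ u ψ))
        → (∀ n → T ⊢ (θ ⇒ (bigOr (λ k → [ omega ]^ k $ (~ g (φ ∧' ~ ψ))) n
                              ∨' [ omega ]^ suc n $ (~ (φ u ψ)))))
        → T ⊢ (θ ⇒ ~ (φ U ψ))

Consistent : Theory → Set₁
Consistent T = ¬ Σ Formula (λ χ → (T ⊢ χ) × (T ⊢ ~ χ))

Complete : Theory → Set₁
Complete T = Consistent T × (∀ φ → (T ⊢ φ) ⊎ (T ⊢ ~ φ))

ExcludedMiddle : Set₂
ExcludedMiddle = (P : Set₁) → P ⊎ ¬ P

module Submission where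

-- Lindenbaum's construction, adapted to the infinitary rules R3 and R4. Enumerate the formulas
-- and build a chain of consistent theories, adding the m-th formula γ if that stays consistent
-- and ¬γ otherwise. When γ is rejected, the negation of one premise of an R3/R4 instance
-- concluding γ is added as well, if this is consistent. If no premise can be refuted
-- consistently, the stage together with ¬γ derives every premise, hence γ, which is absurd; so
-- the union of the chain is closed under R3 and R4. Closure under the finitary rules and
-- consistency hold because finitely many members of the union lie in a common stage.

open import Defs
open import Data.Product using (Σ; _×_; ∃-syntax; _,_; proj₁; map₁)
open import Data.Bool using (true; false)
open import Data.Empty using (⊥-elim)
open import Data.Nat using (ℕ; zero; suc; _<_; _≤_; _⊔_; s≤s; _≤′_; ≤′-refl; ≤′-step)
open import Data.Nat.Properties using (≤-refl; m≤m⊔n; m≤n⊔m; ≤-<-trans; ≤⇒≤′)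
open import Data.Nat.Binary as ℕᵇ using (ℕᵇ; 2[1+_]; 1+[2_]; toℕ; fromℕ)
open import Data.Nat.Binary.Properties using (fromℕ-toℕ)
open import Data.Sum using (_⊎_; inj₁; inj₂)
open import Relation.Nullary using (¬_)
open import Relation.Binary.PropositionalEquality using (_≡_; refl; cong; sym; subst)

taut-weaken : ∀ α β → TautInstance (β ⇒ (α ⇒ β))
taut-weaken α β v with evalP v β | evalP v α
... | false | _     = refl
... | true  | false = refl
... | true  | true  = refl

taut-refl : ∀ α → TautInstance (α ⇒ α)
taut-refl α v with evalP v α
... | true  = refl
... | false = refl

taut-mp-under : ∀ α φ ψ → TautInstance ((α ⇒ φ) ⇒ ((α ⇒ (φ ⇒ ψ)) ⇒ (α ⇒ ψ)))
taut-mp-under α φ ψ v with evalP v α | evalP v φ | evalP v ψ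
... | false | _     | _     = refl
... | true  | false | _     = refl
... | true  | true  | true  = refl
... | true  | true  | false = refl

taut-uncurry : ∀ α θ χ → TautInstance ((α ⇒ (θ ⇒ χ)) ⇒ ((α ∧' θ) ⇒ χ))
taut-uncurry α θ χ v with evalP v α | evalP v θ | evalP v χ
... | false | _     | _     = refl
... | true  | false | _     = refl
... | true  | true  | true  = refl
... | true  | true  | false = refl

taut-curry : ∀ α θ χ → TautInstance (((α ∧' θ) ⇒ χ) ⇒ (α ⇒ (θ ⇒ χ)))
taut-curry α θ χ v with evalP v α | evalP v θ | evalP v χ
... | false | _     | _     = refl
... | true  | false | _     = refl
... | true  | true  | true  = refl
... | true  | true  | false = refl

taut-¬-intro : ∀ γ χ → TautInstance ((γ ⇒ χ) ⇒ ((γ ⇒ ~ χ) ⇒ ~ γ))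
taut-¬-intro γ χ v with evalP v γ | evalP v χ
... | false | _     = refl
... | true  | true  = refl
... | true  | false = refl

taut-¬-elim : ∀ δ χ → TautInstance ((~ δ ⇒ χ) ⇒ ((~ δ ⇒ ~ χ) ⇒ δ))
taut-¬-elim δ χ v with evalP v δ | evalP v χ
... | true  | _     = refl
... | false | true  = refl
... | false | false = refl

infixl 6 _∪⟨_⟩

_∪⟨_⟩ : Theory → Formula → Theory
(T ∪⟨ γ ⟩) χ = T χ ⊎ χ ≡ γ

⊢-taut : ∀ {T φ ψ} → T ⊢ φ → TautInstance (φ ⇒ ψ) → T ⊢ ψ
⊢-taut d t = R1 d (ax (A1 t))

⊢-taut₂ : ∀ {T φ ψ χ} → T ⊢ φ → T ⊢ ψ → TautInstance (φ ⇒ (ψ ⇒ χ)) → T ⊢ χ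
⊢-taut₂ d e t = R1 e (⊢-taut d t)

⊢-mono : ∀ {T S φ} → T ⊆ S → T ⊢ φ → S ⊢ φ
⊢-mono T⊆S (ax a)    = ax a
⊢-mono T⊆S (hyp t)   = hyp (T⊆S _ t)
⊢-mono T⊆S (R1 d e)  = R1 (⊢-mono T⊆S d) (⊢-mono T⊆S e)
⊢-mono T⊆S (R2 a d)  = R2 a d
⊢-mono T⊆S (R3 d ds) = R3 (⊢-mono T⊆S d) (λ n → ⊢-mono T⊆S (ds n))
⊢-mono T⊆S (R4 d ds) = R4 (⊢-mono T⊆S d) (λ n → ⊢-mono T⊆S (ds n))

R3-premise : Formula → Formula → ℕ → Formula
R3-premise φ ψ n = bigOr (λ k → [ one ]^ k $ (~ φ ∨' ψ)) n ∨' [ one ]^ suc n $ (~ ψ)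

R4-premise : Formula → Formula → ℕ → Formula
R4-premise φ ψ n = bigOr (λ k → [ omega ]^ k $ (~ g (φ ∧' ~ ψ))) n ∨' [ omega ]^ suc n $ (~ (φ u ψ))

-- The infinitary rules keep the deduction theorem because their premises carry an arbitrary
-- antecedent θ, into which the discharged hypothesis is absorbed as α ∧' θ.
deduction : ∀ {T α β} → T ∪⟨ α ⟩ ⊢ β → T ⊢ (α ⇒ β)
deduction {α = α} {β} (ax a)            = ⊢-taut (ax a) (taut-weaken α β)
deduction {α = α} {β} (hyp (inj₁ t))    = ⊢-taut (hyp t) (taut-weaken α β)
deduction {α = α}     (hyp (inj₂ refl)) = ax (A1 (taut-refl α))
deduction {α = α}     (R1 {φ = φ} {ψ} d e) =
  ⊢-taut₂ (deduction d) (deduction e) (taut-mp-under α φ ψ)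
deduction {α = α} {β} (R2 a d)          = ⊢-taut (R2 a d) (taut-weaken α β)
deduction {α = α} (R3 {θ = θ} {φ} {ψ} d ds) =
  ⊢-taut (R3 {θ = α ∧' θ}
             (⊢-taut (deduction d) (taut-uncurry α θ (~ ψ)))
             (λ n → ⊢-taut (deduction (ds n)) (taut-uncurry α θ (R3-premise φ ψ n))))
         (taut-curry α θ (~ (φ u ψ)))
deduction {α = α} (R4 {θ = θ} {φ} {ψ} d ds) =
  ⊢-taut (R4 {θ = α ∧' θ}
             (⊢-taut (deduction d) (taut-uncurry α θ (~ (φ u ψ))))
             (λ n → ⊢-taut (deduction (ds n)) (taut-uncurry α θ (R4-premise φ ψ n))))
         (taut-curry α θ (~ (φ U ψ)))

Inconsistent : Theory → Set₁
Inconsistent T = Σ Formula (λ χ → (T ⊢ χ) × (T ⊢ ~ χ))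

refute : ∀ {T γ} → Inconsistent (T ∪⟨ γ ⟩) → T ⊢ ~ γ
refute {γ = γ} (χ , d , e) = ⊢-taut₂ (deduction d) (deduction e) (taut-¬-intro γ χ)

by-contradiction : ∀ {T δ} → Inconsistent (T ∪⟨ ~ δ ⟩) → T ⊢ δ
by-contradiction {δ = δ} (χ , d , e) = ⊢-taut₂ (deduction d) (deduction e) (taut-¬-elim δ χ)

consistent-∪-¬ : ∀ {T γ} → Consistent T → Inconsistent (T ∪⟨ γ ⟩) → Consistent (T ∪⟨ ~ γ ⟩)
consistent-∪-¬ con inc inc~ = con (_ , by-contradiction inc~ , refute inc)

pattern O r = 2[1+ r ]
pattern I r = 1+[2 r ]

unary : ℕ → ℕᵇ → ℕᵇ
unary zero    r = O r
unary (suc n) r = I (unary n r)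

readUnary : ℕᵇ → ℕ × ℕᵇ
readUnary (I r) = map₁ suc (readUnary r)
readUnary (O r) = zero , r
readUnary r     = zero , r

readUnary-unary : ∀ n r → readUnary (unary n r) ≡ (n , r)
readUnary-unary zero    r = refl
readUnary-unary (suc n) r = cong (map₁ suc) (readUnary-unary n r)

-- Polish notation, three bits per connective.
serialise : Formula → ℕᵇ → ℕᵇ
serialise (var n)  r = O (O (O (unary n r)))
serialise (~ φ)    r = O (O (I (serialise φ r)))
serialise ([1] φ)  r = O (I (O (serialise φ r)))
serialise ([ω] φ)  r = O (I (I (serialise φ r)))
serialise (φ ∧' ψ) r = I (O (O (serialise φ (serialise ψ r))))
serialise (φ u ψ)  r = I (O (I (serialise φ (serialise ψ r))))
serialise (φ U ψ)  r = I (I (O (serialise φ (serialise ψ r))))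

parseBinary : (Formula → Formula → Formula) → (ℕᵇ → Formula × ℕᵇ) → ℕᵇ → Formula × ℕᵇ
parseBinary c parse r = let (φ , r₁) = parse r ; (ψ , r₂) = parse r₁ in c φ ψ , r₂

-- The first argument is fuel; ill-formed input and exhausted fuel yield junk.
parse : ℕ → ℕᵇ → Formula × ℕᵇ
parse (suc n) (O (O (O r))) = map₁ var (readUnary r)
parse (suc n) (O (O (I r))) = map₁ ~_ (parse n r)
parse (suc n) (O (I (O r))) = map₁ [1]_ (parse n r)
parse (suc n) (O (I (I r))) = map₁ [ω]_ (parse n r)
parse (suc n) (I (O (O r))) = parseBinary _∧'_ (parse n) r
parse (suc n) (I (O (I r))) = parseBinary _u_ (parse n) r
parse (suc n) (I (I (O r))) = parseBinary _U_ (parse n) r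
parse _       r             = var zero , r

depth : Formula → ℕ
depth (var _)  = zero
depth (~ φ)    = suc (depth φ)
depth ([1] φ)  = suc (depth φ)
depth ([ω] φ)  = suc (depth φ)
depth (φ ∧' ψ) = suc (depth φ ⊔ depth ψ)
depth (φ u ψ)  = suc (depth φ ⊔ depth ψ)
depth (φ U ψ)  = suc (depth φ ⊔ depth ψ)

parse-serialise : ∀ φ {n} r → depth φ < n → parse n (serialise φ r) ≡ (φ , r)
parseBinary-serialise : ∀ c φ ψ {n} r → depth φ ⊔ depth ψ < n →
                        parseBinary c (parse n) (serialise φ (serialise ψ r)) ≡ (c φ ψ , r)

parse-serialise (var k)  r (s≤s _) = cong (map₁ var) (readUnary-unary k r)
parse-serialise (~ φ)    r (s≤s d) = cong (map₁ ~_) (parse-serialise φ r d)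
parse-serialise ([1] φ)  r (s≤s d) = cong (map₁ [1]_) (parse-serialise φ r d)
parse-serialise ([ω] φ)  r (s≤s d) = cong (map₁ [ω]_) (parse-serialise φ r d)
parse-serialise (φ ∧' ψ) r (s≤s d) = parseBinary-serialise _∧'_ φ ψ r d
parse-serialise (φ u ψ)  r (s≤s d) = parseBinary-serialise _u_ φ ψ r d
parse-serialise (φ U ψ)  r (s≤s d) = parseBinary-serialise _U_ φ ψ r d

parseBinary-serialise c φ ψ r d
  rewrite parse-serialise φ (serialise ψ r) (≤-<-trans (m≤m⊔n _ _) d)
        | parse-serialise ψ r (≤-<-trans (m≤n⊔m _ _) d) = refl

-- A code carries the fuel its parse needs, in unary in front of the formula.
code : Formula → ℕ
code φ = toℕ (unary (depth φ) (serialise φ ℕᵇ.zero))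

enumerate : ℕ → Formula
enumerate m = let (fuel , r) = readUnary (fromℕ m) in proj₁ (parse (suc fuel) r)

enumerate-code : ∀ φ → enumerate (code φ) ≡ φ
enumerate-code φ
  rewrite fromℕ-toℕ (unary (depth φ) (serialise φ ℕᵇ.zero))
        | readUnary-unary (depth φ) (serialise φ ℕᵇ.zero)
        | parse-serialise φ ℕᵇ.zero (s≤s ≤-refl) = refl

data Premise : Formula → Formula → Set where
  R3-base : ∀ θ φ ψ → Premise (θ ⇒ ~ (φ u ψ)) (θ ⇒ ~ ψ)
  R3-step : ∀ θ φ ψ n → Premise (θ ⇒ ~ (φ u ψ)) (θ ⇒ R3-premise φ ψ n)
  R4-base : ∀ θ φ ψ → Premise (θ ⇒ ~ (φ U ψ)) (θ ⇒ ~ (φ u ψ))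
  R4-step : ∀ θ φ ψ n → Premise (θ ⇒ ~ (φ U ψ)) (θ ⇒ R4-premise φ ψ n)

Witness : Theory → Formula → Set₁
Witness T γ = Σ Formula (λ δ → Premise γ δ × Consistent (T ∪⟨ ~ γ ⟩ ∪⟨ ~ δ ⟩))

data Extension (T : Theory) (γ : Formula) : Set₁ where
  accept           : Consistent (T ∪⟨ γ ⟩) → Extension T γ
  reject-witnessed : (δ : Formula) → Premise γ δ → Consistent (T ∪⟨ ~ γ ⟩ ∪⟨ ~ δ ⟩) → Extension T γ
  reject           : Inconsistent (T ∪⟨ γ ⟩) → ¬ Witness T γ → Extension T γ

extend : ∀ {T γ} → Extension T γ → Theory
extend {T} {γ} (accept _)                = T ∪⟨ γ ⟩
extend {T} {γ} (reject-witnessed δ _ _)  = T ∪⟨ ~ γ ⟩ ∪⟨ ~ δ ⟩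
extend {T} {γ} (reject _ _)              = T ∪⟨ ~ γ ⟩

⊆-extend : ∀ {T γ} (e : Extension T γ) → T ⊆ extend e
⊆-extend (accept _)               _ x = inj₁ x
⊆-extend (reject-witnessed _ _ _) _ x = inj₁ (inj₁ x)
⊆-extend (reject _ _)             _ x = inj₁ x

extend-consistent : ∀ {T γ} → Consistent T → (e : Extension T γ) → Consistent (extend e)
extend-consistent _   (accept con)               = con
extend-consistent _   (reject-witnessed _ _ con) = con
extend-consistent con (reject inc _)             = consistent-∪-¬ con inc

extend-decides : ∀ {T γ} (e : Extension T γ) → extend e γ ⊎ extend e (~ γ)
extend-decides (accept _)               = inj₁ (inj₂ refl)
extend-decides (reject-witnessed _ _ _) = inj₂ (inj₁ (inj₂ refl))
extend-decides (reject _ _)             = inj₂ (inj₂ refl)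

module _ (lem : ExcludedMiddle) where

  inconsistent : ∀ {T} → ¬ Consistent T → Inconsistent T
  inconsistent {T} ¬con with lem (Inconsistent T)
  ... | inj₁ inc  = inc
  ... | inj₂ ¬inc = ⊥-elim (¬con ¬inc)

  extension : ∀ T γ → Extension T γ
  extension T γ with lem (Consistent (T ∪⟨ γ ⟩)) | lem (Witness T γ)
  ... | inj₁ con  | _                  = accept con
  ... | inj₂ _    | inj₁ (δ , p , con) = reject-witnessed δ p con
  ... | inj₂ ¬con | inj₂ ¬wit          = reject (inconsistent ¬con) ¬wit

module Lindenbaum (lem : ExcludedMiddle) (T₀ : Theory) (con₀ : Consistent T₀) where

  stage : ℕ → Theory
  stage zero    = T₀
  stage (suc m) = extend (extension lem (stage m) (enumerate m))

  stage-consistent : ∀ m → Consistent (stage m)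
  stage-consistent zero    = con₀
  stage-consistent (suc m) = extend-consistent (stage-consistent m) (extension lem _ _)

  stage-mono : ∀ {i j} → i ≤ j → stage i ⊆ stage j
  stage-mono i≤j = go (≤⇒≤′ i≤j)
    where
      go : ∀ {i j} → i ≤′ j → stage i ⊆ stage j
      go ≤′-refl     _ x = x
      go (≤′-step p) χ x = ⊆-extend (extension lem _ _) χ (go p χ x)

  limit : Theory
  limit χ = ∃[ m ] stage m χ

  common-stage : ∀ {χ ψ} → limit χ → limit ψ → ∃[ k ] stage k χ × stage k ψ
  common-stage (i , x) (j , y) = i ⊔ j , stage-mono (m≤m⊔n i j) _ x , stage-mono (m≤n⊔m i j) _ y

  limit-coherent : ∀ {χ} → limit χ → ¬ limit (~ χ)
  limit-coherent x y with common-stage x y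
  ... | k , x′ , y′ = stage-consistent k (_ , hyp x′ , hyp y′)

  ⊆-limit-at-code : ∀ γ → extend (extension lem (stage (code γ)) γ) ⊆ limit
  ⊆-limit-at-code γ χ x =
    suc (code γ) , subst (λ ψ → extend (extension lem (stage (code γ)) ψ) χ) (sym (enumerate-code γ)) x

  limit-decides : ∀ γ → limit γ ⊎ limit (~ γ)
  limit-decides γ with extend-decides (extension lem (stage (code γ)) γ)
  ... | inj₁ x = inj₁ (⊆-limit-at-code γ _ x)
  ... | inj₂ x = inj₂ (⊆-limit-at-code γ _ x)

  stage-derivable⇒limit : ∀ {k γ} → stage k ⊢ γ → limit γ
  stage-derivable⇒limit {k} {γ} d with limit-decides γ
  ... | inj₁ x       = x
  ... | inj₂ (j , y) = ⊥-elim (stage-consistent (k ⊔ j)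
          (γ , ⊢-mono (stage-mono (m≤m⊔n k j)) d , hyp (stage-mono (m≤n⊔m k j) _ y)))

  limit-closed-under-rule : ∀ γ → (∀ δ → Premise γ δ → limit δ) →
                            (∀ {T} → (∀ δ → Premise γ δ → T ⊢ δ) → T ⊢ γ) → limit γ
  limit-closed-under-rule γ premises rule = go (extension lem S γ) (⊆-limit-at-code γ)
    where
      S = stage (code γ)
      go : (e : Extension S γ) → extend e ⊆ limit → limit γ
      go (accept _)               ⊆lim = ⊆lim _ (inj₂ refl)
      go (reject-witnessed δ p _) ⊆lim = ⊥-elim (limit-coherent (premises δ p) (⊆lim _ (inj₂ refl)))
      go (reject inc ¬wit)        _    =
        ⊥-elim (consistent-∪-¬ (stage-consistent (code γ)) inc (γ , rule derive , hyp (inj₂ refl)))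
        where
          derive : ∀ δ → Premise γ δ → S ∪⟨ ~ γ ⟩ ⊢ δ
          derive δ p = by-contradiction (inconsistent lem (λ con → ¬wit (δ , p , con)))

  limit-closed : ∀ {φ} → limit ⊢ φ → limit φ
  limit-closed (ax a)   = stage-derivable⇒limit {k = zero} (ax a)
  limit-closed (hyp x)  = x
  limit-closed (R1 d e) with common-stage (limit-closed d) (limit-closed e)
  ... | k , x , y = stage-derivable⇒limit {k} (R1 (hyp x) (hyp y))
  limit-closed (R2 a d) = stage-derivable⇒limit {k = zero} (R2 a d)
  limit-closed (R3 {θ = θ} {φ} {ψ} d ds) =
    limit-closed-under-rule _ premises (λ h → R3 (h _ (R3-base θ φ ψ)) (λ n → h _ (R3-step θ φ ψ n)))
    where
      premises : ∀ δ → Premise (θ ⇒ ~ (φ u ψ)) δ → limit δ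
      premises _ (R3-base _ _ _)   = limit-closed d
      premises _ (R3-step _ _ _ n) = limit-closed (ds n)
  limit-closed (R4 {θ = θ} {φ} {ψ} d ds) =
    limit-closed-under-rule _ premises (λ h → R4 (h _ (R4-base θ φ ψ)) (λ n → h _ (R4-step θ φ ψ n)))
    where
      premises : ∀ δ → Premise (θ ⇒ ~ (φ U ψ)) δ → limit δ
      premises _ (R4-base _ _ _)   = limit-closed d
      premises _ (R4-step _ _ _ n) = limit-closed (ds n)

  limit-complete : Complete limit
  limit-complete = (λ (χ , d , e) → limit-coherent (limit-closed d) (limit-closed e)) , decides
    where
      decides : ∀ φ → (limit ⊢ φ) ⊎ (limit ⊢ ~ φ)
      decides φ with limit-decides φ
      ... | inj₁ x = inj₁ (hyp x)
      ... | inj₂ x = inj₂ (hyp x)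

mainTheorem5 : ExcludedMiddle → (T : Theory) → NonEmpty T → Consistent T →
    Σ Theory (λ T' → NonEmpty T' × (T ⊆ T') × Complete T')
mainTheorem5 lem T (φ , φ∈T) con = limit , (φ , zero , φ∈T) , (λ _ x → zero , x) , limit-complete
  where open Lindenbaum lem T con
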